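{- Let $f=(f(n))_{n\ge1}$ be a sequence of nonzero integers that is multiplicative (i.e. $f(ab)=f(a)f(b)$ whenever $a,b\in\mathbb{Z}^+$ are coprime) and is a divisibility sequence (i.e. $k\mid n$ implies $f(k)\mid f(n)$ for $k,n\in\mathbb{Z}^+$). Then $f$ is a divisor-product: there is an integer sequence $g$ with $f(n)=\prod_{d\mid n}g(d)$ for all $n\ge1$.
   Context: The product $\prod_{d\mid n}$ runs over the positive divisors $d$ of $n$. -}

module Defs where

open import Data.Nat as ℕ using (ℕ; suc)
open import Data.Nat.Divisibility using (_∣?_) renaming (_∣_ to _∣ℕ_)
open import Data.Nat.Coprimality using (Coprime)
open import Data.Integer as ℤ using (ℤ; 0ℤ; 1ℤ)
open import Data.Integer.Divisibility as ℤD using ()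
open import Data.List using (List; map; filter; foldr)
open import Data.List.Base using (upTo)
open import Relation.Binary.PropositionalEquality using (_≡_)
open import Relation.Nullary using (¬_)

-- Sequences are functions ℕ → ℤ; only the values at n ≥ 1 matter
-- (every condition below only refers to positive arguments).

divisors : ℕ → List ℕ
divisors n = filter (_∣? n) (map suc (upTo n))

divisorProduct : (ℕ → ℤ) → ℕ → ℤ
divisorProduct g n = foldr (λ d acc → g d ℤ.* acc) 1ℤ (divisors n)

NonzeroSeq : (ℕ → ℤ) → Set
NonzeroSeq f = ∀ n → 1 ℕ.≤ n → ¬ (f n ≡ 0ℤ)

Multiplicative : (ℕ → ℤ) → Set
Multiplicative f = ∀ a b → 1 ℕ.≤ a → 1 ℕ.≤ b → Coprime a b → f (a ℕ.* b) ≡ f a ℤ.* f b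

DivisibilitySeq : (ℕ → ℤ) → Set
DivisibilitySeq f = ∀ k n → 1 ℕ.≤ k → 1 ℕ.≤ n → k ∣ℕ n → f k ℤD.∣ f n

-- Let g(q^(j+1)) = f(q^(j+1)) / f(q^j) for primes q (an integer because f is a divisibility
-- sequence) and g(d) = 1 when d is not a prime power. Since g is supported on prime powers, the
-- divisors d of a coprime product x y with g(d) ≠ 1 divide exactly one of x and y, so the
-- divisor product of g is multiplicative. On prime powers it telescopes to
-- g(p) g(p^2) ⋯ g(p^a) = f(p^a). Two multiplicative sequences agreeing on prime powers agree.
module Submission where

open import Defs
open import Data.Nat as ℕ
  using (ℕ; zero; suc; _≤_; _<_; _^_; z≤n; s≤s; z<s; >-nonZero; nonTrivial⇒n>1)
import Data.Nat.Properties as ℕ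
open import Data.Nat.Induction using (<-rec)
open import Data.Nat.Divisibility
  using (_∣?_; divides; ∣-refl; ∣-trans; ∣1⇒≡1; >⇒∤; n∣m*n; m∣m*n; ∣m⇒∣m*n; ∣n⇒∣m*n)
  renaming (_∣_ to _∣ℕ_)
open import Data.Nat.Coprimality using (Coprime; coprime-divisor; 1-coprimeTo)
import Data.Nat.Coprimality as Coprime
open import Data.Nat.Primality
  using (Prime; prime?; prime[2]; prime⇒nonZero; prime⇒nonTrivial; prime⇒irreducible; ¬prime[1]; euclidsLemma)
open import Data.Nat.Primality.Factorisation using (factorise)
open import Data.Nat.ListAction using (product)
open import Data.Integer as ℤ using (ℤ; 1ℤ; _*_)
import Data.Integer.Properties as ℤ
open import Data.Integer.Divisibility.Signed using (∣ᵤ⇒∣; quotient)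
import Data.Integer.Divisibility.Signed as Signed
open import Data.List using (List; []; _∷_; map; filter; foldr; upTo; applyUpTo)
open import Data.List.Properties using (map-upTo)
open import Data.List.Relation.Unary.All using (_∷_)
open import Data.Product using (Σ; ∃₂; _×_; _,_)
open import Data.Sum using (_⊎_; inj₁; inj₂; [_,_]′)
open import Function using (_∘_; _⇔_; mk⇔; Equivalence)
open import Relation.Nullary using (Dec; yes; no; ¬_; contradiction)
open import Relation.Nullary.Decidable using (_×-dec_; map′)
open import Relation.Unary using (Decidable)
open import Relation.Binary.PropositionalEquality
open import Algebra.Properties.CommutativeSemigroup ℤ.*-commutativeSemigroup using (interchange)

onlyIf : {P : Set} → Dec P → ℤ → ℤ
onlyIf (yes _) x = x
onlyIf (no _)  _ = 1ℤ

onlyIf-yes : {P : Set} (P? : Dec P) (x : ℤ) → P → onlyIf P? x ≡ x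
onlyIf-yes (yes _) x _ = refl
onlyIf-yes (no ¬p) x p = contradiction p ¬p

onlyIf-no : {P : Set} (P? : Dec P) (x : ℤ) → ¬ P → onlyIf P? x ≡ 1ℤ
onlyIf-no (yes p) x ¬p = contradiction p ¬p
onlyIf-no (no _)  x _  = refl

onlyIf-1 : {P : Set} (P? : Dec P) → onlyIf P? 1ℤ ≡ 1ℤ
onlyIf-1 (yes _) = refl
onlyIf-1 (no _)  = refl

onlyIf-cong : {P Q : Set} (P? : Dec P) (Q? : Dec Q) (x : ℤ) → P ⇔ Q → onlyIf P? x ≡ onlyIf Q? x
onlyIf-cong (yes p) Q? x P⇔Q = sym (onlyIf-yes Q? x (Equivalence.to P⇔Q p))
onlyIf-cong (no ¬p) Q? x P⇔Q = sym (onlyIf-no Q? x (¬p ∘ Equivalence.from P⇔Q))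

listProduct : (ℕ → ℤ) → List ℕ → ℤ
listProduct c = foldr (λ d acc → c d * acc) 1ℤ

productUpTo : (ℕ → ℤ) → ℕ → ℤ
productUpTo c zero    = 1ℤ
productUpTo c (suc n) = productUpTo c n * c (suc n)

listProduct-filter : ∀ {P : ℕ → Set} (P? : Decidable P) c xs →
                     listProduct c (filter P? xs) ≡ listProduct (λ x → onlyIf (P? x) (c x)) xs
listProduct-filter P? c []       = refl
listProduct-filter P? c (x ∷ xs) with P? x
... | yes _ = cong (c x *_) (listProduct-filter P? c xs)
... | no _  = trans (listProduct-filter P? c xs) (sym (ℤ.*-identityˡ _))

listProduct-applyUpTo-suc : ∀ c (h : ℕ → ℕ) n →
                            listProduct c (applyUpTo h (suc n)) ≡ listProduct c (applyUpTo h n) * c (h n)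
listProduct-applyUpTo-suc c h zero    = trans (ℤ.*-identityʳ (c (h 0))) (sym (ℤ.*-identityˡ (c (h 0))))
listProduct-applyUpTo-suc c h (suc n) = begin
  c (h 0) * listProduct c (applyUpTo (h ∘ suc) (suc n))
    ≡⟨ cong (c (h 0) *_) (listProduct-applyUpTo-suc c (h ∘ suc) n) ⟩
  c (h 0) * (listProduct c (applyUpTo (h ∘ suc) n) * c (h (suc n)))
    ≡⟨ ℤ.*-assoc (c (h 0)) _ _ ⟨
  c (h 0) * listProduct c (applyUpTo (h ∘ suc) n) * c (h (suc n)) ∎
  where open ≡-Reasoning

listProduct-applyUpTo : ∀ c n → listProduct c (applyUpTo suc n) ≡ productUpTo c n
listProduct-applyUpTo c zero    = refl
listProduct-applyUpTo c (suc n) =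
  trans (listProduct-applyUpTo-suc c suc n) (cong (_* c (suc n)) (listProduct-applyUpTo c n))

productUpTo-cong : ∀ c c′ n → (∀ d → 1 ≤ d → d ≤ n → c d ≡ c′ d) → productUpTo c n ≡ productUpTo c′ n
productUpTo-cong c c′ zero    c≗c′ = refl
productUpTo-cong c c′ (suc n) c≗c′ =
  cong₂ _*_ (productUpTo-cong c c′ n (λ d 1≤d d≤n → c≗c′ d 1≤d (ℕ.m≤n⇒m≤1+n d≤n)))
            (c≗c′ (suc n) (s≤s z≤n) ℕ.≤-refl)

productUpTo-distrib-* : ∀ c c′ n → productUpTo (λ d → c d * c′ d) n ≡ productUpTo c n * productUpTo c′ n
productUpTo-distrib-* c c′ zero    = refl
productUpTo-distrib-* c c′ (suc n) = begin
  productUpTo (λ d → c d * c′ d) n * (c (suc n) * c′ (suc n))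
    ≡⟨ cong (_* (c (suc n) * c′ (suc n))) (productUpTo-distrib-* c c′ n) ⟩
  (productUpTo c n * productUpTo c′ n) * (c (suc n) * c′ (suc n))
    ≡⟨ interchange (productUpTo c n) (productUpTo c′ n) (c (suc n)) (c′ (suc n)) ⟩
  (productUpTo c n * c (suc n)) * (productUpTo c′ n * c′ (suc n)) ∎
  where open ≡-Reasoning

productUpTo-trailing-ones : ∀ c {m} n → m ≤ n → (∀ d → m < d → d ≤ n → c d ≡ 1ℤ) →
                            productUpTo c n ≡ productUpTo c m
productUpTo-trailing-ones c zero    z≤n   ones = refl
productUpTo-trailing-ones c {m} (suc n) m≤1+n ones with m ℕ.≟ suc n
... | yes refl = refl
... | no m≢1+n = begin
  productUpTo c n * c (suc n)
    ≡⟨ cong₂ _*_ (productUpTo-trailing-ones c n m≤n (λ d m<d d≤n → ones d m<d (ℕ.m≤n⇒m≤1+n d≤n)))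
                 (ones (suc n) (s≤s m≤n) ℕ.≤-refl) ⟩
  productUpTo c m * 1ℤ
    ≡⟨ ℤ.*-identityʳ _ ⟩
  productUpTo c m ∎
  where
  open ≡-Reasoning
  m≤n = ℕ.m<1+n⇒m≤n (ℕ.≤∧≢⇒< m≤1+n m≢1+n)

divisorFactor : (ℕ → ℤ) → ℕ → ℕ → ℤ
divisorFactor g n d = onlyIf (d ∣? n) (g d)

divisorProduct-productUpTo : ∀ g n → divisorProduct g n ≡ productUpTo (divisorFactor g n) n
divisorProduct-productUpTo g n = begin
  listProduct g (filter (_∣? n) (map suc (upTo n)))
    ≡⟨ listProduct-filter (_∣? n) g (map suc (upTo n)) ⟩
  listProduct (divisorFactor g n) (map suc (upTo n))
    ≡⟨ cong (listProduct (divisorFactor g n)) (map-upTo suc n) ⟩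
  listProduct (divisorFactor g n) (applyUpTo suc n)
    ≡⟨ listProduct-applyUpTo (divisorFactor g n) n ⟩
  productUpTo (divisorFactor g n) n ∎
  where open ≡-Reasoning

productUpTo-divisorFactor : ∀ g {m} n → 1 ≤ m → m ≤ n → productUpTo (divisorFactor g m) n ≡ divisorProduct g m
productUpTo-divisorFactor g {m} n 1≤m m≤n = begin
  productUpTo (divisorFactor g m) n
    ≡⟨ productUpTo-trailing-ones (divisorFactor g m) n m≤n
         (λ d m<d _ → onlyIf-no (d ∣? m) (g d) (>⇒∤ {{>-nonZero 1≤m}} m<d)) ⟩
  productUpTo (divisorFactor g m) m
    ≡⟨ divisorProduct-productUpTo g m ⟨
  divisorProduct g m ∎
  where open ≡-Reasoning

prime⇒1< : ∀ {p} → Prime p → 1 < p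
prime⇒1< {p} pr = nonTrivial⇒n>1 p {{prime⇒nonTrivial pr}}

1<p^suc : ∀ {p} → Prime p → ∀ j → 1 < p ^ suc j
1<p^suc {p} pr j = ℕ.^-monoʳ-< p (prime⇒1< pr) (z<s {j})

n<m^n : ∀ {m} → 1 < m → ∀ n → n < m ^ n
n<m^n {m} 1<m zero    = z<s
n<m^n {m} 1<m (suc n) = ℕ.≤-<-trans (n<m^n 1<m n) (ℕ.^-monoʳ-< m 1<m (ℕ.n<1+n n))

PrimePower : ℕ → Set
PrimePower d = ∃₂ λ q j → Prime q × d ≡ q ^ suc j

¬PrimePower[1] : ¬ PrimePower 1
¬PrimePower[1] (q , j , pq , 1≡q^sj) = ℕ.<⇒≢ (1<p^suc pq j) 1≡q^sj

primePower? : Decidable PrimePower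
primePower? d =
  map′ (λ { (q , _ , j , _ , pq , eq) → q , j , pq , eq }) bounded
       (ℕ.anyUpTo? (λ q → ℕ.anyUpTo? (λ j → prime? q ×-dec d ℕ.≟ q ^ suc j) d) (suc d))
  where
  bounded : PrimePower d → Σ ℕ λ q → q < suc d × Σ ℕ λ j → j < d × Prime q × d ≡ q ^ suc j
  bounded (q , j , pq , refl) =
    q , s≤s (ℕ.m≤m*n q (q ^ j) {{ℕ.m^n≢0 q j {{prime⇒nonZero pq}}}}) ,
    j , ℕ.<-trans (ℕ.n<1+n j) (n<m^n (prime⇒1< pq) (suc j)) , pq , refl

prime-∣-prime : ∀ {p q} → Prime p → Prime q → q ∣ℕ p → q ≡ p
prime-∣-prime pp pq q∣p with prime⇒irreducible pp q∣p
... | inj₁ refl = contradiction pq ¬prime[1]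
... | inj₂ q≡p  = q≡p

prime-∣-^ : ∀ {p q} → Prime q → ∀ n → q ∣ℕ p ^ n → q ∣ℕ p
prime-∣-^ pq zero    q∣1 = contradiction (subst Prime (∣1⇒≡1 q∣1) pq) ¬prime[1]
prime-∣-^ {p} pq (suc n) q∣p^sn with euclidsLemma p (p ^ n) pq q∣p^sn
... | inj₁ q∣p   = q∣p
... | inj₂ q∣p^n = prime-∣-^ pq n q∣p^n

prime-power-injective : ∀ {p q i j} → Prime p → Prime q → p ^ suc i ≡ q ^ suc j → p ≡ q × p ^ i ≡ q ^ j
prime-power-injective {p} {q} {i} {j} pp pq eq =
  p≡q , ℕ.*-cancelˡ-≡ (p ^ i) (q ^ j) p {{prime⇒nonZero pp}} (trans eq (cong (λ r → r ℕ.* q ^ j) (sym p≡q)))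
  where
  p≡q : p ≡ q
  p≡q = prime-∣-prime pq pp (prime-∣-^ pp (suc j) (subst (p ∣ℕ_) eq (m∣m*n (p ^ i))))

coprime-∣ˡ : ∀ {d m n} → d ∣ℕ m → Coprime m n → Coprime d n
coprime-∣ˡ d∣m cop (e∣d , e∣n) = cop (∣-trans e∣d d∣m , e∣n)

coprime-*ˡ : ∀ {a b c} → Coprime a c → Coprime b c → Coprime (a ℕ.* b) c
coprime-*ˡ {a} cop-ac cop-bc {d} (d∣ab , d∣c) = cop-bc (coprime-divisor d⊥a d∣ab , d∣c)
  where
  d⊥a : Coprime d a
  d⊥a (e∣d , e∣a) = cop-ac (e∣a , ∣-trans e∣d d∣c)

coprime-^ˡ : ∀ {a b} → Coprime a b → ∀ k → Coprime (a ^ k) b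
coprime-^ˡ {b = b} cop zero    = 1-coprimeTo b
coprime-^ˡ         cop (suc k) = coprime-*ˡ cop (coprime-^ˡ cop k)

prime-∤⇒coprime : ∀ {p m} → Prime p → ¬ p ∣ℕ m → Coprime p m
prime-∤⇒coprime pr p∤m {d} (d∣p , d∣m) with prime⇒irreducible pr d∣p
... | inj₁ d≡1 = d≡1
... | inj₂ refl = contradiction d∣m p∤m

-- A cofactor e of d in p^(a+1) is either 1 or a multiple of p.
∣p^suc⇒∣p^ : ∀ {p d} → Prime p → ∀ a → d ∣ℕ p ^ suc a → d ≢ p ^ suc a → d ∣ℕ p ^ a
∣p^suc⇒∣p^ {p} {d} pr a (divides e p^sa≡e*d) d≢p^sa with p ∣? e
... | yes (divides e′ refl) = divides e′ (ℕ.*-cancelˡ-≡ (p ^ a) (e′ ℕ.* d) p {{prime⇒nonZero pr}} (begin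
  p ℕ.* p ^ a         ≡⟨ p^sa≡e*d ⟩
  e′ ℕ.* p ℕ.* d      ≡⟨ cong (ℕ._* d) (ℕ.*-comm e′ p) ⟩
  p ℕ.* e′ ℕ.* d      ≡⟨ ℕ.*-assoc p e′ d ⟩
  p ℕ.* (e′ ℕ.* d)    ∎))
  where open ≡-Reasoning
... | no p∤e = contradiction (begin
  d           ≡⟨ ℕ.*-identityˡ d ⟨
  1 ℕ.* d     ≡⟨ cong (ℕ._* d) e≡1 ⟨
  e ℕ.* d     ≡⟨ p^sa≡e*d ⟨
  p ^ suc a   ∎) d≢p^sa
  where
  open ≡-Reasoning
  e≡1 : e ≡ 1
  e≡1 = Coprime.sym (coprime-^ˡ (prime-∤⇒coprime pr p∤e) (suc a))
          (∣-refl , divides d (trans p^sa≡e*d (ℕ.*-comm e d)))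

prime-power-∣-coprime-* : ∀ {q m n} → Prime q → ∀ j → Coprime m n →
                          q ^ suc j ∣ℕ m ℕ.* n → q ^ suc j ∣ℕ m ⊎ q ^ suc j ∣ℕ n
prime-power-∣-coprime-* {q} {m} {n} pq j cop Q∣mn with euclidsLemma m n pq (∣-trans (m∣m*n (q ^ j)) Q∣mn)
... | inj₁ q∣m = inj₁ (coprime-divisor (coprime-^ˡ (coprime-∣ˡ q∣m cop) (suc j))
                                       (subst (q ^ suc j ∣ℕ_) (ℕ.*-comm m n) Q∣mn))
... | inj₂ q∣n = inj₂ (coprime-divisor (coprime-^ˡ (coprime-∣ˡ q∣n (Coprime.sym cop)) (suc j)) Q∣mn)

prime-divisor : ∀ {n} → 1 < n → Σ ℕ λ p → Prime p × p ∣ℕ n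
prime-divisor {n} 1<n with factorise n {{>-nonZero (ℕ.<-trans z<s 1<n)}}
... | record { factors = [] ; isFactorisation = n≡1 } = contradiction n≡1 (ℕ.>⇒≢ 1<n)
... | record { factors = p ∷ ps ; isFactorisation = n≡p*ps ; factorsPrime = pr ∷ _ } =
  p , pr , divides (product ps) (trans n≡p*ps (ℕ.*-comm p (product ps)))

p-free-decomposition : ∀ {p} → Prime p → ∀ n → 1 ≤ n → ∃₂ λ a m → n ≡ p ^ a ℕ.* m × ¬ p ∣ℕ m
p-free-decomposition {p} pr = <-rec _ step
  where
  step : ∀ n → (∀ {k} → k < n → 1 ≤ k → ∃₂ λ a m → k ≡ p ^ a ℕ.* m × ¬ p ∣ℕ m) →
         1 ≤ n → ∃₂ λ a m → n ≡ p ^ a ℕ.* m × ¬ p ∣ℕ m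
  step n rec 1≤n with p ∣? n
  ... | no p∤n = 0 , n , sym (ℕ.*-identityˡ n) , p∤n
  ... | yes (divides k@(suc _) refl) with rec (ℕ.m<m*n k p (prime⇒1< pr)) (s≤s z≤n)
  ...   | a , m , k≡p^a*m , p∤m = suc a , m , (begin
    k ℕ.* p               ≡⟨ cong (ℕ._* p) k≡p^a*m ⟩
    p ^ a ℕ.* m ℕ.* p     ≡⟨ ℕ.*-comm (p ^ a ℕ.* m) p ⟩
    p ℕ.* (p ^ a ℕ.* m)   ≡⟨ ℕ.*-assoc p (p ^ a) m ⟨
    p ^ suc a ℕ.* m       ∎) , p∤m
    where open ≡-Reasoning

SupportedOnPrimePowers : (ℕ → ℤ) → Set
SupportedOnPrimePowers g = ∀ d → g d ≡ 1ℤ ⊎ PrimePower d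

supported⇒g[1]≡1 : ∀ {g} → SupportedOnPrimePowers g → g 1 ≡ 1ℤ
supported⇒g[1]≡1 supp with supp 1
... | inj₁ g[1]≡1 = g[1]≡1
... | inj₂ pp     = contradiction pp ¬PrimePower[1]

divisorProduct-step : ∀ g {m} n → 1 ≤ m → m < n → (∀ {d} → 1 ≤ d → d < n → d ∣ℕ n ⇔ d ∣ℕ m) →
                      divisorProduct g n ≡ divisorProduct g m * g n
divisorProduct-step g {m} (suc n) 1≤m m<1+n same-divisors = begin
  divisorProduct g (suc n)
    ≡⟨ divisorProduct-productUpTo g (suc n) ⟩
  productUpTo (divisorFactor g (suc n)) n * onlyIf (suc n ∣? suc n) (g (suc n))
    ≡⟨ cong₂ _*_ (productUpTo-cong _ _ n (λ d 1≤d d≤n →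
                    onlyIf-cong (d ∣? suc n) (d ∣? m) (g d) (same-divisors 1≤d (s≤s d≤n))))
                 (onlyIf-yes (suc n ∣? suc n) (g (suc n)) ∣-refl) ⟩
  productUpTo (divisorFactor g m) n * g (suc n)
    ≡⟨ cong (_* g (suc n)) (productUpTo-divisorFactor g n 1≤m (ℕ.≤-pred m<1+n)) ⟩
  divisorProduct g m * g (suc n) ∎
  where open ≡-Reasoning

divisorProduct-p^suc : ∀ g {p} → Prime p → ∀ a →
                       divisorProduct g (p ^ suc a) ≡ divisorProduct g (p ^ a) * g (p ^ suc a)
divisorProduct-p^suc g {p} pr a =
  divisorProduct-step g (p ^ suc a) (ℕ.m^n>0 p {{prime⇒nonZero pr}} a) (ℕ.^-monoʳ-< p (prime⇒1< pr) (ℕ.n<1+n a))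
    (λ _ d<p^sa → mk⇔ (λ d∣p^sa → ∣p^suc⇒∣p^ pr a d∣p^sa (ℕ.<⇒≢ d<p^sa)) (λ d∣p^a → ∣-trans d∣p^a (n∣m*n p)))

divisorProduct-primePower : ∀ {f g : ℕ → ℤ} → SupportedOnPrimePowers g → f 1 ≡ 1ℤ →
                            (∀ {p} → Prime p → ∀ a → g (p ^ suc a) * f (p ^ a) ≡ f (p ^ suc a)) →
                            ∀ {p} → Prime p → ∀ a → divisorProduct g (p ^ a) ≡ f (p ^ a)
divisorProduct-primePower {f} {g} supp f[1]≡1 ratio pr zero = begin
  g 1 * 1ℤ  ≡⟨ ℤ.*-identityʳ (g 1) ⟩
  g 1       ≡⟨ supported⇒g[1]≡1 supp ⟩
  1ℤ        ≡⟨ f[1]≡1 ⟨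
  f 1       ∎
  where open ≡-Reasoning
divisorProduct-primePower {f} {g} supp f[1]≡1 ratio {p} pr (suc a) = begin
  divisorProduct g (p ^ suc a)               ≡⟨ divisorProduct-p^suc g pr a ⟩
  divisorProduct g (p ^ a) * g (p ^ suc a)   ≡⟨ cong (_* g (p ^ suc a)) (divisorProduct-primePower {f} supp f[1]≡1 ratio pr a) ⟩
  f (p ^ a) * g (p ^ suc a)                  ≡⟨ ℤ.*-comm (f (p ^ a)) (g (p ^ suc a)) ⟩
  g (p ^ suc a) * f (p ^ a)                  ≡⟨ ratio pr a ⟩
  f (p ^ suc a)                              ∎
  where open ≡-Reasoning

-- A prime power dividing x y divides exactly one of the coprime factors x and y.
divisorFactor-* : ∀ {g} → SupportedOnPrimePowers g → ∀ {x y} → Coprime x y → ∀ d →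
                  divisorFactor g (x ℕ.* y) d ≡ divisorFactor g x d * divisorFactor g y d
divisorFactor-* {g} supp {x} {y} cop d with supp d
... | inj₁ g[d]≡1 rewrite g[d]≡1 =
  trans (onlyIf-1 (d ∣? x ℕ.* y)) (sym (cong₂ _*_ (onlyIf-1 (d ∣? x)) (onlyIf-1 (d ∣? y))))
... | inj₂ (q , j , pq , refl) with d ∣? x | d ∣? y
...   | yes d∣x | yes d∣y = contradiction (cop (d∣x , d∣y)) (ℕ.>⇒≢ (1<p^suc pq j))
...   | yes d∣x | no _    = trans (onlyIf-yes (d ∣? x ℕ.* y) (g d) (∣m⇒∣m*n y d∣x)) (sym (ℤ.*-identityʳ (g d)))
...   | no _    | yes d∣y = trans (onlyIf-yes (d ∣? x ℕ.* y) (g d) (∣n⇒∣m*n x d∣y)) (sym (ℤ.*-identityˡ (g d)))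
...   | no d∤x  | no d∤y  = onlyIf-no (d ∣? x ℕ.* y) (g d) ([ d∤x , d∤y ]′ ∘ prime-power-∣-coprime-* pq j cop)

divisorProduct-multiplicative : ∀ {g} → SupportedOnPrimePowers g → Multiplicative (divisorProduct g)
divisorProduct-multiplicative {g} supp x y 1≤x 1≤y cop = begin
  divisorProduct g (x ℕ.* y)
    ≡⟨ divisorProduct-productUpTo g (x ℕ.* y) ⟩
  productUpTo (divisorFactor g (x ℕ.* y)) (x ℕ.* y)
    ≡⟨ productUpTo-cong _ _ (x ℕ.* y) (λ d _ _ → divisorFactor-* supp cop d) ⟩
  productUpTo (λ d → divisorFactor g x d * divisorFactor g y d) (x ℕ.* y)
    ≡⟨ productUpTo-distrib-* (divisorFactor g x) (divisorFactor g y) (x ℕ.* y) ⟩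
  productUpTo (divisorFactor g x) (x ℕ.* y) * productUpTo (divisorFactor g y) (x ℕ.* y)
    ≡⟨ cong₂ _*_ (productUpTo-divisorFactor g (x ℕ.* y) 1≤x (ℕ.m≤m*n x y {{>-nonZero 1≤y}}))
                 (productUpTo-divisorFactor g (x ℕ.* y) 1≤y (ℕ.m≤n*m y x {{>-nonZero 1≤x}})) ⟩
  divisorProduct g x * divisorProduct g y ∎
  where open ≡-Reasoning

multiplicative-≡-on-primePowers : ∀ {f h : ℕ → ℤ} → Multiplicative f → Multiplicative h →
                                  (∀ p a → Prime p → f (p ^ a) ≡ h (p ^ a)) → ∀ n → 1 ≤ n → f n ≡ h n
multiplicative-≡-on-primePowers {f} {h} f-mult h-mult agree = <-rec _ step
  where
  step : ∀ n → (∀ {m} → m < n → 1 ≤ m → f m ≡ h m) → 1 ≤ n → f n ≡ h n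
  step (suc zero) _ _ = agree 2 0 prime[2]
  step n@(suc (suc _)) rec 1≤n with prime-divisor {n} (s≤s (s≤s z≤n))
  ... | p , pr , p∣n with p-free-decomposition pr n 1≤n
  ...   | zero  , m , n≡m , p∤m = contradiction (subst (p ∣ℕ_) (trans n≡m (ℕ.*-identityˡ m)) p∣n) p∤m
  ...   | suc a , zero , _ , p∤0 = contradiction (divides 0 refl) p∤0
  ...   | suc a , m@(suc _) , n≡P*m , p∤m = begin
    f n               ≡⟨ cong f n≡P*m ⟩
    f (P ℕ.* m)       ≡⟨ f-mult P m 1≤P (s≤s z≤n) P⊥m ⟩
    f P * f m         ≡⟨ cong₂ _*_ (agree p (suc a) pr) (rec m<n (s≤s z≤n)) ⟩
    h P * h m         ≡⟨ h-mult P m 1≤P (s≤s z≤n) P⊥m ⟨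
    h (P ℕ.* m)       ≡⟨ cong h n≡P*m ⟨
    h n               ∎
    where
    open ≡-Reasoning
    P = p ^ suc a
    1≤P : 1 ≤ P
    1≤P = ℕ.<⇒≤ (1<p^suc pr a)
    P⊥m : Coprime P m
    P⊥m = coprime-^ˡ (prime-∤⇒coprime pr p∤m) (suc a)
    m<n : m < n
    m<n = subst (m <_) (trans (ℕ.*-comm m P) (sym n≡P*m)) (ℕ.m<m*n m P (1<p^suc pr a))

f[p^a]∣f[p^suc-a] : ∀ {f : ℕ → ℤ} → DivisibilitySeq f → ∀ {p} → Prime p → ∀ a → f (p ^ a) Signed.∣ f (p ^ suc a)
f[p^a]∣f[p^suc-a] f-dvs {p} pr a =
  ∣ᵤ⇒∣ (f-dvs (p ^ a) (p ^ suc a) (ℕ.m^n>0 p {{prime⇒nonZero pr}} a) (ℕ.<⇒≤ (1<p^suc pr a)) (n∣m*n p))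

primePowerRatio : ∀ f → DivisibilitySeq f → ℕ → ℤ
primePowerRatio f f-dvs d with primePower? d
... | yes (q , j , pq , _) = quotient (f[p^a]∣f[p^suc-a] {f} f-dvs pq j)
... | no _                 = 1ℤ

primePowerRatio-supported : ∀ f f-dvs → SupportedOnPrimePowers (primePowerRatio f f-dvs)
primePowerRatio-supported f f-dvs d with primePower? d
... | yes pp = inj₂ pp
... | no _   = inj₁ refl

primePowerRatio-* : ∀ f f-dvs {p} → Prime p → ∀ a →
                    primePowerRatio f f-dvs (p ^ suc a) * f (p ^ a) ≡ f (p ^ suc a)
primePowerRatio-* f f-dvs {p} pr a with primePower? (p ^ suc a)
... | no ¬pp = contradiction (p , a , pr , refl) ¬pp
... | yes (q , j , pq , p^sa≡q^sj) with prime-power-injective {i = a} {j = j} pr pq p^sa≡q^sj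
...   | refl , p^a≡q^j = begin
  quotient q^j∣q^sj * f (p ^ a)   ≡⟨ cong (λ r → quotient q^j∣q^sj * f r) p^a≡q^j ⟩
  quotient q^j∣q^sj * f (p ^ j)   ≡⟨ Signed._∣_.equality q^j∣q^sj ⟨
  f (p ^ suc j)                   ≡⟨ cong f p^sa≡q^sj ⟨
  f (p ^ suc a)                   ∎
  where
  open ≡-Reasoning
  q^j∣q^sj = f[p^a]∣f[p^suc-a] {f} f-dvs pq j

nonzero-multiplicative⇒f[1]≡1 : ∀ {f : ℕ → ℤ} → NonzeroSeq f → Multiplicative f → f 1 ≡ 1ℤ
nonzero-multiplicative⇒f[1]≡1 {f} f≢0 f-mult =
  sym (ℤ.*-cancelˡ-≡ (f 1) 1ℤ (f 1) {{ℤ.≢-nonZero (f≢0 1 ℕ.≤-refl)}}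
        (trans (ℤ.*-identityʳ (f 1)) (f-mult 1 1 ℕ.≤-refl ℕ.≤-refl (1-coprimeTo 1))))

proposition3p7 : (f : ℕ → ℤ) → NonzeroSeq f → Multiplicative f → DivisibilitySeq f →
    Σ (ℕ → ℤ) (λ g → ∀ n → 1 ≤ n → f n ≡ divisorProduct g n)
proposition3p7 f f≢0 f-mult f-dvs =
  g , multiplicative-≡-on-primePowers f-mult (divisorProduct-multiplicative supported) agree
  where
  g = primePowerRatio f f-dvs
  supported = primePowerRatio-supported f f-dvs
  agree : ∀ p a → Prime p → f (p ^ a) ≡ divisorProduct g (p ^ a)
  agree p a pr = sym (divisorProduct-primePower {f} supported (nonzero-multiplicative⇒f[1]≡1 f≢0 f-mult)
                                                 (primePowerRatio-* f f-dvs) pr a)
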